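{- Let $n,m$ be positive integers, let $T\subset\mathbb{Q}\cup\{\infty\}$ be finite, and let $\mathscr{M}$ be a solvable $n\times m$ RK puzzle with slope set $T$. If the $(i,j)$-entry of $\mathscr{M}$ is uniquely solvable, then the $(n-i+1,m-j+1)$-entry of $\mathscr{M}$ is also uniquely solvable.
   Context: For a positive integer $n$ let $I_n=\{1,\dots,n\}$, and let $I_{n,m}=I_n\times I_m\subset\mathbb{R}^2$, viewed as lattice points in the Cartesian plane. For a slope $s\in\mathbb{Q}\cup\{\infty\}$ let $\mathscr{L}_s$ be the set of lines $\ell\subset\mathbb{R}^2$ of slope $s$ with $\ell\cap I_{n,m}\neq\emptyset$. For $\ell\in\mathscr{L}_s$ the clue polynomial is $P_{\ell,s}(X)=\sum_{(i,j)\in\ell\cap I_{n,m}}X_{i,j}$ in the $nm$ variables $X_{i,j}$. An $n\times m$ RK puzzle with (finite) slope set $T$ is a system of linear equations consisting of one equation $P_{\ell,t}(X)=c_{\ell,t}$, with arbitrary $c_{\ell,t}\in\mathbb{R}$, for every $t\in T$ and every $\ell\in\mathscr{L}_t$. A solution is a real solution of this system; the puzzle is solvable if it has a solution. The $(i,j)$-entry is the variable $X_{i,j}$; it is uniquely solvable if all solutions of the puzzle have the same value of $X_{i,j}$. -}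

module Defs where

open import Level using (Level; _⊔_) renaming (suc to lsuc)
open import Algebra.Bundles using (CommutativeRing)
open import Data.Nat using (ℕ; zero; suc)
open import Data.Fin using (Fin; toℕ)
open import Data.Integer as ℤ using (ℤ; +_)
open import Data.Rational using (ℚ; ↥_; ↧_)
open import Data.Sum using (_⊎_; inj₁; inj₂)
open import Data.Unit using (⊤)
open import Data.Product using (Σ; ∃; _×_; _,_)
open import Data.List using (List)
open import Data.List.Membership.Propositional using (_∈_)
open import Relation.Nullary using (¬_; does)
open import Data.Bool using (if_then_else_)

-- A field: a commutative ring with 0 ≠ 1 in which every nonzero element
-- has a multiplicative inverse.  (Stand-in for ℝ.)
record Field (c ℓ : Level) : Set (lsuc (c ⊔ ℓ)) where
  field
    commutativeRing : CommutativeRing c ℓ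
  open CommutativeRing commutativeRing public
  field
    0≉1     : ¬ (0# ≈ 1#)
    inverse : ∀ x → ¬ (x ≈ 0#) → Σ Carrier λ y → x * y ≈ 1#

-- Slopes: Q ∪ {∞}.  inj₁ r is the rational slope r, inj₂ _ is slope ∞.
Slope : Set
Slope = ℚ ⊎ ⊤

-- Line key: two lattice points lie on the same line of slope t iff they have
-- the same key.  For slope r = p/q (q > 0, reduced) the lines of slope r are
-- q·y − p·x = const, and a line meets the lattice only if const ∈ ℤ; for slope
-- ∞ the lines are x = const.  Lattice point with 0-based Fin indices (i , j)
-- is the paper's point (i+1 , j+1).
key : ∀ {n m} → Slope → Fin n → Fin m → ℤ
key (inj₁ r) i j = (↧ r) ℤ.* (+ suc (toℕ j)) ℤ.- (↥ r) ℤ.* (+ suc (toℕ i))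
key (inj₂ _) i j = + suc (toℕ i)

module _ {c ℓ} (F : Field c ℓ) where
  open Field F

  ∑ : ∀ {n} → (Fin n → Carrier) → Carrier
  ∑ {zero}  f = 0#
  ∑ {suc n} f = f Fin.zero + ∑ (λ i → f (Fin.suc i))

  Assignment : ℕ → ℕ → Set c
  Assignment n m = Fin n → Fin m → Carrier

  clue : ∀ {n m} → Slope → ℤ → Assignment n m → Carrier
  clue t k X = ∑ λ i → ∑ λ j → if does (key t i j ℤ.≟ k) then X i j else 0#

  -- An n×m RK puzzle with slope set T: the constants c_{ℓ,t}, given as a
  -- function of the slope and the line (key).  One equation for every t ∈ T
  -- and every line ℓ ∈ 𝓛_t (i.e. every line meeting I_{n,m}, which are
  -- exactly the lines through some lattice point (i,j)).
  Constants : Set c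
  Constants = Slope → ℤ → Carrier

  IsSolution : ∀ {n m} → List Slope → Constants → Assignment n m → Set ℓ
  IsSolution {n} {m} T C X =
    ∀ t → t ∈ T → (i : Fin n) (j : Fin m) → clue t (key t i j) X ≈ C t (key t i j)

  Solvable : ℕ → ℕ → List Slope → Constants → Set (c ⊔ ℓ)
  Solvable n m T C = ∃ λ (X : Assignment n m) → IsSolution T C X

  UniquelySolvable : ∀ {n m} → List Slope → Constants → Fin n → Fin m → Set (c ⊔ ℓ)
  UniquelySolvable {n} {m} T C i j =
    ∀ (X Y : Assignment n m) → IsSolution T C X → IsSolution T C Y → X i j ≈ Y i j

{-# OPTIONS --safe #-}
-- The point reflection (x , y) ↦ (n + 1 − x , m + 1 − y) of I_{n,m} maps every line of
-- slope t meeting I_{n,m} onto another such line, so it preserves the solutions of the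
-- homogeneous puzzle (all constants 0).  If X and Y are solutions, the reflection Z of
-- X − Y is homogeneous, hence X + Z is again a solution; uniqueness at (i , j) forces
-- Z i j = 0, i.e. X and Y agree at the opposite entry.
module Submission where

open import Defs
open import Data.Nat using (ℕ; _≤_)
open import Data.Fin using (Fin; opposite)
open import Data.List using (List)

open import Data.Bool using (true; false; if_then_else_)
open import Data.Fin as Fin using (toℕ)
open import Data.Fin.Permutation as Permutation using ()
open import Data.Fin.Properties using (opposite-prop; opposite-involutive; toℕ<n)
open import Data.Integer as ℤ using (ℤ; +_; _⊖_)
import Data.Integer.Properties as ℤ
open import Data.Integer.Tactic.RingSolver using (solve-∀)
import Data.Nat as ℕ
import Data.Nat.Properties as ℕ
open import Data.Rational using (↥_; ↧_)
open import Data.Sum using (inj₁; inj₂)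
open import Function using (_∘_; _⇔_; mk⇔)
open import Relation.Binary.PropositionalEquality as ≡ using (_≡_; module ≡-Reasoning)
open import Relation.Nullary using (does)
open import Relation.Nullary.Decidable using (does-⇔)

lineKey : Slope → ℤ → ℤ → ℤ
lineKey (inj₁ r) x y = ↧ r ℤ.* y ℤ.- ↥ r ℤ.* x
lineKey (inj₂ _) x y = x

lineKey-sub : ∀ t a b x y → lineKey t (a ℤ.- x) (b ℤ.- y) ≡ lineKey t a b ℤ.- lineKey t x y
lineKey-sub (inj₁ r) a b x y = linear (↧ r) (↥ r) a b x y
  where
  linear : ∀ q p a b x y → q ℤ.* (b ℤ.- y) ℤ.- p ℤ.* (a ℤ.- x) ≡ (q ℤ.* b ℤ.- p ℤ.* a) ℤ.- (q ℤ.* y ℤ.- p ℤ.* x)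
  linear = solve-∀
lineKey-sub (inj₂ _) a b x y = ≡.refl

coord : ∀ {n} → Fin n → ℤ
coord i = + ℕ.suc (toℕ i)

key≡lineKey : ∀ {n m} t (i : Fin n) (j : Fin m) → key t i j ≡ lineKey t (coord i) (coord j)
key≡lineKey (inj₁ _) i j = ≡.refl
key≡lineKey (inj₂ _) i j = ≡.refl

coord-opposite : ∀ {n} (i : Fin n) → coord (opposite i) ≡ + ℕ.suc n ℤ.- coord i
coord-opposite {n} i = begin
  + ℕ.suc (toℕ (opposite i))       ≡⟨ ≡.cong (+_ ∘ ℕ.suc) (opposite-prop i) ⟩
  + ℕ.suc (n ℕ.∸ ℕ.suc (toℕ i))    ≡⟨ ≡.cong +_ (ℕ.+-∸-assoc 1 (toℕ<n i)) ⟨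
  + (ℕ.suc n ℕ.∸ ℕ.suc (toℕ i))    ≡⟨ ℤ.⊖-≥ (ℕ.<⇒≤ (ℕ.s<s (toℕ<n i))) ⟨
  ℕ.suc n ⊖ ℕ.suc (toℕ i)          ≡⟨ ℤ.[+m]-[+n]≡m⊖n (ℕ.suc n) (ℕ.suc (toℕ i)) ⟨
  + ℕ.suc n ℤ.- coord i            ∎
  where open ≡-Reasoning

cornerKey : ℕ → ℕ → Slope → ℤ
cornerKey n m t = lineKey t (+ ℕ.suc n) (+ ℕ.suc m)

key-opposite : ∀ {n m} t (i : Fin n) (j : Fin m) →
  key t (opposite i) (opposite j) ≡ cornerKey n m t ℤ.- key t i j
key-opposite {n} {m} t i j = begin
  key t (opposite i) (opposite j)                               ≡⟨ key≡lineKey t (opposite i) (opposite j) ⟩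
  lineKey t (coord (opposite i)) (coord (opposite j))          ≡⟨ ≡.cong₂ (lineKey t) (coord-opposite i) (coord-opposite j) ⟩
  lineKey t (+ ℕ.suc n ℤ.- coord i) (+ ℕ.suc m ℤ.- coord j)    ≡⟨ lineKey-sub t _ _ (coord i) (coord j) ⟩
  cornerKey n m t ℤ.- lineKey t (coord i) (coord j)            ≡⟨ ≡.cong (λ z → cornerKey n m t ℤ.- z) (key≡lineKey t i j) ⟨
  cornerKey n m t ℤ.- key t i j                                ∎
  where open ≡-Reasoning

m-n≡o⇔n≡m-o : ∀ m n o → m ℤ.- n ≡ o ⇔ n ≡ m ℤ.- o
m-n≡o⇔n≡m-o m n o = mk⇔
  (λ eq → ≡.trans (≡.sym (m-[m-n]≡n m n)) (≡.cong (λ z → m ℤ.- z) eq))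
  (λ eq → ≡.trans (≡.cong (λ z → m ℤ.- z) eq) (m-[m-n]≡n m o))
  where
  m-[m-n]≡n : ∀ m n → m ℤ.- (m ℤ.- n) ≡ n
  m-[m-n]≡n = solve-∀

on-opposite-line : ∀ {n m} t (i : Fin n) (j : Fin m) k →
  does (key t (opposite i) (opposite j) ℤ.≟ k) ≡ does (key t i j ℤ.≟ cornerKey n m t ℤ.- k)
on-opposite-line {n} {m} t i j k rewrite key-opposite t i j =
  does-⇔ (m-n≡o⇔n≡m-o (cornerKey n m t) (key t i j) k)
    (cornerKey n m t ℤ.- key t i j ℤ.≟ k) (key t i j ℤ.≟ cornerKey n m t ℤ.- k)

module _ {c ℓ} (F : Field c ℓ) where
  open Field F
  open import Algebra.Properties.Ring ring
    using (-0#≈0#; -‿+-comm; +-identityʳ-unique)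
  open import Algebra.Properties.Semiring.Sum semiring
    using (sum; sum-cong-≋; ∑-distrib-+; sum-permute)
  open import Relation.Binary.Reasoning.Setoid setoid

  ∑≡sum : ∀ {n} (f : Fin n → Carrier) → ∑ F f ≡ sum f
  ∑≡sum {ℕ.zero}  f = ≡.refl
  ∑≡sum {ℕ.suc n} f = ≡.cong (λ s → f Fin.zero + s) (∑≡sum (f ∘ Fin.suc))

  sum-neg : ∀ {n} (f : Fin n → Carrier) → sum (λ i → - f i) ≈ - sum f
  sum-neg {ℕ.zero}  f = sym -0#≈0#
  sum-neg {ℕ.suc n} f = trans (+-congˡ (sum-neg (f ∘ Fin.suc))) (-‿+-comm _ _)

  sum-opposite : ∀ {n} (f : Fin n → Carrier) → sum (f ∘ opposite) ≈ sum f
  sum-opposite f = sym (sum-permute f Permutation.reverse)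

  ∑∑ : ∀ {n m} → (Fin n → Fin m → Carrier) → Carrier
  ∑∑ A = sum (λ i → sum (A i))

  ∑∑-cong : ∀ {n m} {A B : Fin n → Fin m → Carrier} → (∀ i j → A i j ≈ B i j) → ∑∑ A ≈ ∑∑ B
  ∑∑-cong {n} {m} A≈B = sum-cong-≋ {n} (λ i → sum-cong-≋ {m} (A≈B i))

  ∑∑-distrib-+ : ∀ {n m} (A B : Fin n → Fin m → Carrier) →
    ∑∑ (λ i j → A i j + B i j) ≈ ∑∑ A + ∑∑ B
  ∑∑-distrib-+ {n} A B = trans (sum-cong-≋ {n} (λ i → ∑-distrib-+ (A i) (B i)))
                                (∑-distrib-+ (λ i → sum (A i)) (λ i → sum (B i)))

  ∑∑-neg : ∀ {n m} (A : Fin n → Fin m → Carrier) → ∑∑ (λ i j → - A i j) ≈ - ∑∑ A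
  ∑∑-neg {n} A = trans (sum-cong-≋ {n} (λ i → sum-neg (A i))) (sum-neg (λ i → sum (A i)))

  ∑∑-opposite : ∀ {n m} (A : Fin n → Fin m → Carrier) →
    ∑∑ (λ i j → A (opposite i) (opposite j)) ≈ ∑∑ A
  ∑∑-opposite {n} A = trans (sum-cong-≋ {n} (λ i → sum-opposite (A (opposite i))))
                             (sum-opposite (λ i → sum (A i)))

  module _ {n m : ℕ} where

    infixl 6 _⊕_
    infix  8 ⊝_

    _⊕_ : Assignment F n m → Assignment F n m → Assignment F n m
    (X ⊕ Y) i j = X i j + Y i j

    ⊝_ : Assignment F n m → Assignment F n m
    (⊝ X) i j = - X i j

    rotate : Assignment F n m → Assignment F n m
    rotate X i j = X (opposite i) (opposite j)

    onLine : Slope → ℤ → Assignment F n m → Assignment F n m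
    onLine t k X i j = if does (key t i j ℤ.≟ k) then X i j else 0#

    clue≈∑∑-onLine : ∀ t k X → clue F t k X ≈ ∑∑ (onLine t k X)
    clue≈∑∑-onLine t k X =
      trans (reflexive (∑≡sum (λ i → ∑ F (onLine t k X i))))
            (sum-cong-≋ {n} (λ i → reflexive (∑≡sum (onLine t k X i))))

    onLine-⊕ : ∀ t k X Y i j → onLine t k (X ⊕ Y) i j ≈ onLine t k X i j + onLine t k Y i j
    onLine-⊕ t k X Y i j with does (key t i j ℤ.≟ k)
    ... | true  = refl
    ... | false = sym (+-identityʳ 0#)

    onLine-⊝ : ∀ t k X i j → onLine t k (⊝ X) i j ≈ - onLine t k X i j
    onLine-⊝ t k X i j with does (key t i j ℤ.≟ k)
    ... | true  = refl
    ... | false = sym -0#≈0#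

    onLine-rotate : ∀ t k X i j →
      onLine t k (rotate X) (opposite i) (opposite j) ≡ onLine t (cornerKey n m t ℤ.- k) X i j
    onLine-rotate t k X i j
      rewrite on-opposite-line t i j k | opposite-involutive i | opposite-involutive j = ≡.refl

    clue-⊕ : ∀ t k X Y → clue F t k (X ⊕ Y) ≈ clue F t k X + clue F t k Y
    clue-⊕ t k X Y = begin
      clue F t k (X ⊕ Y)                        ≈⟨ clue≈∑∑-onLine t k (X ⊕ Y) ⟩
      ∑∑ (onLine t k (X ⊕ Y))                   ≈⟨ ∑∑-cong (onLine-⊕ t k X Y) ⟩
      ∑∑ (onLine t k X ⊕ onLine t k Y)          ≈⟨ ∑∑-distrib-+ (onLine t k X) (onLine t k Y) ⟩
      ∑∑ (onLine t k X) + ∑∑ (onLine t k Y)     ≈⟨ +-cong (clue≈∑∑-onLine t k X) (clue≈∑∑-onLine t k Y) ⟨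
      clue F t k X + clue F t k Y               ∎

    clue-⊝ : ∀ t k X → clue F t k (⊝ X) ≈ - clue F t k X
    clue-⊝ t k X = begin
      clue F t k (⊝ X)          ≈⟨ clue≈∑∑-onLine t k (⊝ X) ⟩
      ∑∑ (onLine t k (⊝ X))     ≈⟨ ∑∑-cong (onLine-⊝ t k X) ⟩
      ∑∑ (⊝ onLine t k X)       ≈⟨ ∑∑-neg (onLine t k X) ⟩
      - ∑∑ (onLine t k X)       ≈⟨ -‿cong (clue≈∑∑-onLine t k X) ⟨
      - clue F t k X            ∎

    clue-rotate : ∀ t k X → clue F t k (rotate X) ≈ clue F t (cornerKey n m t ℤ.- k) X
    clue-rotate t k X = begin
      clue F t k (rotate X)                      ≈⟨ clue≈∑∑-onLine t k (rotate X) ⟩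
      ∑∑ (onLine t k (rotate X))                 ≈⟨ ∑∑-opposite (onLine t k (rotate X)) ⟨
      ∑∑ (rotate (onLine t k (rotate X)))        ≈⟨ ∑∑-cong (λ i j → reflexive (onLine-rotate t k X i j)) ⟩
      ∑∑ (onLine t k′ X)                         ≈⟨ clue≈∑∑-onLine t k′ X ⟨
      clue F t k′ X                              ∎
      where k′ = cornerKey n m t ℤ.- k

    Homogeneous : List Slope → Assignment F n m → Set ℓ
    Homogeneous T = IsSolution F T (λ _ _ → 0#)

    solution-difference : ∀ {T C X Y} → IsSolution F T C X → IsSolution F T C Y →
      Homogeneous T (X ⊕ ⊝ Y)
    solution-difference {X = X} {Y} solX solY t t∈T i j = begin
      clue F t k (X ⊕ ⊝ Y)               ≈⟨ clue-⊕ t k X (⊝ Y) ⟩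
      clue F t k X + clue F t k (⊝ Y)    ≈⟨ +-congˡ (clue-⊝ t k Y) ⟩
      clue F t k X - clue F t k Y        ≈⟨ +-cong (solX t t∈T i j) (-‿cong (solY t t∈T i j)) ⟩
      _ - _                              ≈⟨ -‿inverseʳ _ ⟩
      0#                                 ∎
      where k = key t i j

    solution-⊕-homogeneous : ∀ {T C X Z} → IsSolution F T C X → Homogeneous T Z →
      IsSolution F T C (X ⊕ Z)
    solution-⊕-homogeneous {X = X} {Z} solX homZ t t∈T i j = begin
      clue F t k (X ⊕ Z)             ≈⟨ clue-⊕ t k X Z ⟩
      clue F t k X + clue F t k Z    ≈⟨ +-cong (solX t t∈T i j) (homZ t t∈T i j) ⟩
      _ + 0#                         ≈⟨ +-identityʳ _ ⟩
      _                              ∎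
      where k = key t i j

    homogeneous-rotate : ∀ {T Z} → Homogeneous T Z → Homogeneous T (rotate Z)
    homogeneous-rotate {Z = Z} homZ t t∈T i j = begin
      clue F t (key t i j) (rotate Z)                          ≈⟨ clue-rotate t (key t i j) Z ⟩
      clue F t (cornerKey n m t ℤ.- key t i j) Z               ≡⟨ ≡.cong (λ k → clue F t k Z) (key-opposite t i j) ⟨
      clue F t (key t (opposite i) (opposite j)) Z             ≈⟨ homZ t t∈T (opposite i) (opposite j) ⟩
      0#                                                       ∎

    uniquelySolvable⇒homogeneous-vanishes : ∀ {T C i j X Z} → UniquelySolvable F T C i j →
      IsSolution F T C X → Homogeneous T Z → Z i j ≈ 0#
    uniquelySolvable⇒homogeneous-vanishes {C = C} {i} {j} {X} {Z} unique solX homZ =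
      +-identityʳ-unique (X i j) (Z i j)
        (sym (unique X (X ⊕ Z) solX (solution-⊕-homogeneous {C = C} solX homZ)))

proposition1 : ∀ {c ℓ} (F : Field c ℓ) (n m : ℕ) → 1 ≤ n → 1 ≤ m →
    (T : List Slope) (C : Constants F) →
    Solvable F n m T C →
    (i : Fin n) (j : Fin m) →
    UniquelySolvable F T C i j →
    UniquelySolvable F T C (opposite i) (opposite j)
-- Solvability is implied by the two solutions that uniqueness quantifies over.
proposition1 F n m _ _ T C _ i j unique X Y solX solY =
  x∙y⁻¹≈ε⇒x≈y _ _ (uniquelySolvable⇒homogeneous-vanishes F {C = C} unique solX
                     (homogeneous-rotate F (solution-difference F {C = C} solX solY)))
  where open import Algebra.Properties.Ring (Field.ring F) using (x∙y⁻¹≈ε⇒x≈y)
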